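{- For $i\in\{1,2,3\}$ and $n\geq1$, the order of $a_i|_{T_n}$ is $2^{m_{i,n}}$, where $m_{1,n}=2\lfloor n/3\rfloor+1$ if $n\equiv2\pmod 3$ and $m_{1,n}=2\lfloor n/3\rfloor$ otherwise; $m_{2,n}=2\lfloor n/3\rfloor$ if $n\equiv0\pmod3$ and $m_{2,n}=2\lfloor n/3\rfloor+1$ otherwise; $m_{3,n}=2\lfloor n/3\rfloor+1$ if $n\equiv1\pmod3$ and $m_{3,n}=2\lfloor (n-1)/3\rfloor+2$ otherwise.
   Context: $T$ is the infinite rooted binary tree of finite words over $\{1,2\}$, $T_n$ the words of length $\le n$, and $x|_{T_n}$ the restriction of $x\in\mathrm{Aut}(T)$ to $T_n$. For automorphisms $u,v$, $(u,v)$ acts by $1w\mapsto1u(w)$, $2w\mapsto2v(w)$; $\sigma$ swaps the first letter; $(u,v)\sigma=(u,v)\circ\sigma$. $a_1,a_2,a_3\in\mathrm{Aut}(T)$ are defined recursively by $a_1=(\mathrm{id},a_3)$, $a_2=(\mathrm{id},a_1)\sigma$, $a_3=(a_2,\mathrm{id})\sigma$. -}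

module Defs where

open import Data.Nat using (ℕ; zero; suc; _+_; _*_; _∸_; _≤_; _<_)
open import Data.Nat.DivMod using (_/_; _%_)
open import Data.List using (List; []; _∷_; length)
open import Data.Product using (_×_)
open import Relation.Nullary using (¬_)
open import Relation.Binary.PropositionalEquality using (_≡_)

data Letter : Set where
  𝟙 𝟚 : Letter

-- Vertices of T: finite words over {1,2}
Word : Set
Word = List Letter

data Gen : Set where
  a₁ a₂ a₃ : Gen

-- Action of a_i on T, unfolded from the wreath recursion
--   a₁ = (id, a₃),  a₂ = (id, a₁)σ,  a₃ = (a₂, id)σ,
-- where (u,v)σ = (u,v) ∘ σ.
act : Gen → Word → Word
act _  []      = []
act a₁ (𝟙 ∷ w) = 𝟙 ∷ w
act a₁ (𝟚 ∷ w) = 𝟚 ∷ act a₃ w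
act a₂ (𝟙 ∷ w) = 𝟚 ∷ act a₁ w
act a₂ (𝟚 ∷ w) = 𝟙 ∷ w
act a₃ (𝟙 ∷ w) = 𝟚 ∷ w
act a₃ (𝟚 ∷ w) = 𝟙 ∷ act a₂ w

iter : (Word → Word) → ℕ → Word → Word
iter f zero    w = w
iter f (suc k) w = f (iter f k w)

IdOnTₙ : ℕ → (Word → Word) → Set
IdOnTₙ n f = ∀ (w : Word) → length w ≤ n → f w ≡ w

OrderOfRestriction : Gen → ℕ → ℕ → Set
OrderOfRestriction i n k =
  (0 < k) × IdOnTₙ n (iter (act i) k)
  × (∀ j → 0 < j → j < k → ¬ IdOnTₙ n (iter (act i) j))

m : Gen → ℕ → ℕ
m a₁ n with n % 3
... | 2 = 2 * (n / 3) + 1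
... | _ = 2 * (n / 3)
m a₂ n with n % 3
... | 0 = 2 * (n / 3)
... | _ = 2 * (n / 3) + 1
m a₃ n with n % 3
... | 1 = 2 * (n / 3) + 1
... | _ = 2 * ((n ∸ 1) / 3) + 2

-- The restriction of a_i to T_(n+1) is governed by the sections of a_i at the
-- first level.  For a₁ = (id, a₃) the j-th power is trivial on T_(n+1) iff a₃ʲ is
-- trivial on T_n.  The generators a₂ and a₃ swap the first letter, so their odd powers
-- are never trivial on T_(n+1), while a₂² = (a₁, a₁) and a₃² = (a₂, a₂) reduce their
-- even powers to the level below.  Hence a_iʲ is trivial on T_n iff 2^(e i n) ∣ j,
-- where e a₁ (n+1) = e a₃ n, e a₂ (n+1) = 1 + e a₁ n, e a₃ (n+1) = 1 + e a₂ n.  Going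
-- once around this cycle adds 2, so e i (n+3) = 2 + e i n, which m also satisfies.
module Submission where

open import Defs
open import Data.Nat using (ℕ; zero; suc; _+_; _*_; _∸_; _≤_; _<_; _^_; z≤n; s≤s; >-nonZero)
open import Data.Nat.Properties using (*-suc; *-comm; +-comm; even≢odd; <⇒≱; m^n>0)
open import Data.Nat.DivMod using (_/_; _%_; [m+n]%n≡m%n; m/n≡1+[m∸n]/n)
open import Data.Nat.Divisibility
  using (_∣_; divides; 1∣_; ∣-refl; ∣⇒≤; m*n∣⇒m∣; *-monoʳ-∣; *-cancelˡ-∣)
open import Data.List using ([]; _∷_)
open import Data.List.Properties using (∷-injectiveʳ)
open import Data.Product using (_,_)
open import Function using (_∘_; _⇔_; mk⇔; Equivalence)
open import Function.Properties.Equivalence using () renaming (sym to ⇔-sym; trans to ⇔-trans)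
open import Relation.Nullary using (¬_; contradiction)
open import Relation.Binary.PropositionalEquality
  using (_≡_; refl; sym; trans; cong; cong₂; subst; module ≡-Reasoning)

open Equivalence using (to; from)

exponent : Gen → ℕ → ℕ
exponent _  zero    = 0
exponent a₁ (suc n) = exponent a₃ n
exponent a₂ (suc n) = suc (exponent a₁ n)
exponent a₃ (suc n) = suc (exponent a₂ n)

iter-[] : ∀ i j → iter (act i) j [] ≡ []
iter-[] i zero    = refl
iter-[] i (suc j) = cong (act i) (iter-[] i j)

iter-double : ∀ (f : Word → Word) k w → iter f (2 * k) w ≡ iter (f ∘ f) k w
iter-double f zero    w = refl
iter-double f (suc k) w =
  trans (cong (λ t → iter f t w) (*-suc 2 k)) (cong (f ∘ f) (iter-double f k w))

iter-a₁-𝟙 : ∀ j w → iter (act a₁) j (𝟙 ∷ w) ≡ 𝟙 ∷ w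
iter-a₁-𝟙 zero    w = refl
iter-a₁-𝟙 (suc j) w = cong (act a₁) (iter-a₁-𝟙 j w)

iter-a₁-𝟚 : ∀ j w → iter (act a₁) j (𝟚 ∷ w) ≡ 𝟚 ∷ iter (act a₃) j w
iter-a₁-𝟚 zero    w = refl
iter-a₁-𝟚 (suc j) w = cong (act a₁) (iter-a₁-𝟚 j w)

IdOnTₙ-a₁ : ∀ n j → IdOnTₙ (suc n) (iter (act a₁) j) ⇔ IdOnTₙ n (iter (act a₃) j)
IdOnTₙ-a₁ n j = mk⇔ restrict extend
  where
  restrict : IdOnTₙ (suc n) (iter (act a₁) j) → IdOnTₙ n (iter (act a₃) j)
  restrict H w l = ∷-injectiveʳ (trans (sym (iter-a₁-𝟚 j w)) (H (𝟚 ∷ w) (s≤s l)))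
  extend : IdOnTₙ n (iter (act a₃) j) → IdOnTₙ (suc n) (iter (act a₁) j)
  extend H []      _       = iter-[] a₁ j
  extend H (𝟙 ∷ w) _       = iter-a₁-𝟙 j w
  extend H (𝟚 ∷ w) (s≤s l) = trans (iter-a₁-𝟚 j w) (cong (𝟚 ∷_) (H w l))

-- a_i = (u, v)σ with a_i² = (uv, vu) = (a_c, a_c).
record SwapSquare (i c : Gen) : Set where
  field
    square : ∀ x w → act i (act i (x ∷ w)) ≡ x ∷ act c w
    flip   : act i (𝟙 ∷ []) ≡ 𝟚 ∷ []

swapSquare-a₂ : SwapSquare a₂ a₁
swapSquare-a₂ = record { square = λ { 𝟙 w → refl ; 𝟚 w → refl } ; flip = refl }

swapSquare-a₃ : SwapSquare a₃ a₂
swapSquare-a₃ = record { square = λ { 𝟙 w → refl ; 𝟚 w → refl } ; flip = refl }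

module _ {i c : Gen} (s : SwapSquare i c) where
  open SwapSquare s

  iter-even : ∀ k x w → iter (act i) (2 * k) (x ∷ w) ≡ x ∷ iter (act c) k w
  iter-even k x w = trans (iter-double (act i) k (x ∷ w)) (squares k)
    where
    squares : ∀ k → iter (act i ∘ act i) k (x ∷ w) ≡ x ∷ iter (act c) k w
    squares zero    = refl
    squares (suc k) = trans (cong (act i ∘ act i) (squares k)) (square x (iter (act c) k w))

  iter-odd-flips : ∀ k → iter (act i) (suc (2 * k)) (𝟙 ∷ []) ≡ 𝟚 ∷ []
  iter-odd-flips k = trans (cong (act i) (trans (iter-even k 𝟙 []) (cong (𝟙 ∷_) (iter-[] c k)))) flip

  IdOnTₙ-even : ∀ n k → IdOnTₙ (suc n) (iter (act i) (2 * k)) ⇔ IdOnTₙ n (iter (act c) k)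
  IdOnTₙ-even n k = mk⇔ restrict extend
    where
    restrict : IdOnTₙ (suc n) (iter (act i) (2 * k)) → IdOnTₙ n (iter (act c) k)
    restrict H w l = ∷-injectiveʳ (trans (sym (iter-even k 𝟙 w)) (H (𝟙 ∷ w) (s≤s l)))
    extend : IdOnTₙ n (iter (act c) k) → IdOnTₙ (suc n) (iter (act i) (2 * k))
    extend H []      _       = iter-[] i (2 * k)
    extend H (x ∷ w) (s≤s l) = trans (iter-even k x w) (cong (x ∷_) (H w l))

  ¬IdOnTₙ-odd : ∀ n k → ¬ IdOnTₙ (suc n) (iter (act i) (suc (2 * k)))
  ¬IdOnTₙ-odd n k H with trans (sym (iter-odd-flips k)) (H (𝟙 ∷ []) (s≤s z≤n))
  ... | ()

data EvenOrOdd : ℕ → Set where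
  even : ∀ k → EvenOrOdd (2 * k)
  odd  : ∀ k → EvenOrOdd (suc (2 * k))

evenOrOdd : ∀ n → EvenOrOdd n
evenOrOdd zero = even 0
evenOrOdd (suc n) with evenOrOdd n
... | even k = odd k
... | odd k  = subst EvenOrOdd (*-suc 2 k) (even (suc k))

2^suc∣2*⇔2^∣ : ∀ e k → 2 ^ suc e ∣ 2 * k ⇔ 2 ^ e ∣ k
2^suc∣2*⇔2^∣ e k = mk⇔ (*-cancelˡ-∣ 2) (*-monoʳ-∣ 2)

2^suc∤odd : ∀ e k → ¬ 2 ^ suc e ∣ suc (2 * k)
2^suc∤odd e k d with m*n∣⇒m∣ 2 (2 ^ e) d
... | divides q eq = even≢odd q k (trans (*-comm 2 q) (sym eq))

IdOnTₙ⇔∣-swap : ∀ {i c} → SwapSquare i c → ∀ n e →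
  (∀ k → IdOnTₙ n (iter (act c) k) ⇔ 2 ^ e ∣ k) →
  ∀ j → IdOnTₙ (suc n) (iter (act i) j) ⇔ 2 ^ suc e ∣ j
IdOnTₙ⇔∣-swap s n e ih j with evenOrOdd j
... | even k = ⇔-trans (IdOnTₙ-even s n k) (⇔-trans (ih k) (⇔-sym (2^suc∣2*⇔2^∣ e k)))
... | odd k  = mk⇔ (λ H → contradiction H (¬IdOnTₙ-odd s n k))
                   (λ d → contradiction d (2^suc∤odd e k))

IdOnTₙ⇔∣ : ∀ i n j → IdOnTₙ n (iter (act i) j) ⇔ 2 ^ exponent i n ∣ j
IdOnTₙ⇔∣ i  zero    j = mk⇔ (λ _ → 1∣ j) (λ { _ [] z≤n → iter-[] i j })
IdOnTₙ⇔∣ a₁ (suc n) j = ⇔-trans (IdOnTₙ-a₁ n j) (IdOnTₙ⇔∣ a₃ n j)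
IdOnTₙ⇔∣ a₂ (suc n) j = IdOnTₙ⇔∣-swap swapSquare-a₂ n (exponent a₁ n) (IdOnTₙ⇔∣ a₁ n) j
IdOnTₙ⇔∣ a₃ (suc n) j = IdOnTₙ⇔∣-swap swapSquare-a₃ n (exponent a₂ n) (IdOnTₙ⇔∣ a₂ n) j

order-of-IdOnTₙ⇔∣ : ∀ i n d → 0 < d →
  (∀ j → IdOnTₙ n (iter (act i) j) ⇔ d ∣ j) → OrderOfRestriction i n d
order-of-IdOnTₙ⇔∣ i n d 0<d char = 0<d , from (char d) ∣-refl , minimal
  where
  minimal : ∀ j → 0 < j → j < d → ¬ IdOnTₙ n (iter (act i) j)
  minimal j 0<j j<d H = <⇒≱ j<d (∣⇒≤ {{>-nonZero 0<j}} (to (char j) H))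

-- m with its case split on n % 3 turned into explicit arguments
-- r = n % 3, q = n / 3 and q′ = (n ∸ 1) / 3.
m′ : Gen → ℕ → ℕ → ℕ → ℕ
m′ a₁ 2 q _  = 2 * q + 1
m′ a₁ _ q _  = 2 * q
m′ a₂ 0 q _  = 2 * q
m′ a₂ _ q _  = 2 * q + 1
m′ a₃ 1 q _  = 2 * q + 1
m′ a₃ _ _ q′ = 2 * q′ + 2

m≡m′ : ∀ i n → m i n ≡ m′ i (n % 3) (n / 3) ((n ∸ 1) / 3)
m≡m′ a₁ n with n % 3
... | 0 = refl
... | 1 = refl
... | 2 = refl
... | suc (suc (suc _)) = refl
m≡m′ a₂ n with n % 3
... | 0 = refl
... | 1 = refl
... | 2 = refl
... | suc (suc (suc _)) = refl
m≡m′ a₃ n with n % 3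
... | 0 = refl
... | 1 = refl
... | 2 = refl
... | suc (suc (suc _)) = refl

m′-step : ∀ i r q q′ → m′ i r (suc q) (suc q′) ≡ 2 + m′ i r q q′
m′-step a₁ 0                   q q′ = *-suc 2 q
m′-step a₁ 1                   q q′ = *-suc 2 q
m′-step a₁ 2                   q q′ = cong (_+ 1) (*-suc 2 q)
m′-step a₁ (suc (suc (suc _))) q q′ = *-suc 2 q
m′-step a₂ 0                   q q′ = *-suc 2 q
m′-step a₂ 1                   q q′ = cong (_+ 1) (*-suc 2 q)
m′-step a₂ 2                   q q′ = cong (_+ 1) (*-suc 2 q)
m′-step a₂ (suc (suc (suc _))) q q′ = cong (_+ 1) (*-suc 2 q)
m′-step a₃ 0                   q q′ = cong (_+ 2) (*-suc 2 q′)
m′-step a₃ 1                   q q′ = cong (_+ 1) (*-suc 2 q)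
m′-step a₃ 2                   q q′ = cong (_+ 2) (*-suc 2 q′)
m′-step a₃ (suc (suc (suc _))) q q′ = cong (_+ 2) (*-suc 2 q′)

[3+n]%3≡n%3 : ∀ n → (3 + n) % 3 ≡ n % 3
[3+n]%3≡n%3 n = trans (cong (_% 3) (+-comm 3 n)) ([m+n]%n≡m%n n 3)

[3+n]/3≡1+n/3 : ∀ n → (3 + n) / 3 ≡ 1 + n / 3
[3+n]/3≡1+n/3 n = m/n≡1+[m∸n]/n {3 + n} (s≤s (s≤s (s≤s z≤n)))

-- Only for positive n: at n = 0 the truncated subtraction makes m a₃ 0 = m a₃ 3 = 2.
m-step : ∀ i n → m i (3 + suc n) ≡ 2 + m i (suc n)
m-step i n = begin
  m i (3 + suc n)
    ≡⟨ m≡m′ i (3 + suc n) ⟩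
  m′ i ((3 + suc n) % 3) ((3 + suc n) / 3) ((3 + n) / 3)
    ≡⟨ cong₂ (λ r q → m′ i r q ((3 + n) / 3)) ([3+n]%3≡n%3 (suc n)) ([3+n]/3≡1+n/3 (suc n)) ⟩
  m′ i (suc n % 3) (1 + suc n / 3) ((3 + n) / 3)
    ≡⟨ cong (m′ i (suc n % 3) (1 + suc n / 3)) ([3+n]/3≡1+n/3 n) ⟩
  m′ i (suc n % 3) (1 + suc n / 3) (1 + n / 3)
    ≡⟨ m′-step i (suc n % 3) (suc n / 3) (n / 3) ⟩
  2 + m′ i (suc n % 3) (suc n / 3) (n / 3)
    ≡⟨ cong (2 +_) (m≡m′ i (suc n)) ⟨
  2 + m i (suc n)
    ∎
  where open ≡-Reasoning

exponent-step : ∀ i n → exponent i (3 + n) ≡ 2 + exponent i n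
exponent-step a₁ n = refl
exponent-step a₂ n = refl
exponent-step a₃ n = refl

exponent≡m : ∀ i n → exponent i (suc n) ≡ m i (suc n)
exponent≡m a₁ 0 = refl
exponent≡m a₂ 0 = refl
exponent≡m a₃ 0 = refl
exponent≡m a₁ 1 = refl
exponent≡m a₂ 1 = refl
exponent≡m a₃ 1 = refl
exponent≡m a₁ 2 = refl
exponent≡m a₂ 2 = refl
exponent≡m a₃ 2 = refl
exponent≡m i (suc (suc (suc n))) = begin
  exponent i (3 + suc n)  ≡⟨ exponent-step i (suc n) ⟩
  2 + exponent i (suc n)  ≡⟨ cong (2 +_) (exponent≡m i n) ⟩
  2 + m i (suc n)         ≡⟨ m-step i n ⟨
  m i (3 + suc n)         ∎
  where open ≡-Reasoning

proposition7p6 : (i : Gen) (n : ℕ) → 1 ≤ n → OrderOfRestriction i n (2 ^ m i n)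
proposition7p6 i (suc n) _ =
  subst (λ e → OrderOfRestriction i (suc n) (2 ^ e)) (exponent≡m i n)
    (order-of-IdOnTₙ⇔∣ i (suc n) (2 ^ exponent i (suc n)) (m^n>0 2 (exponent i (suc n)))
      (IdOnTₙ⇔∣ i (suc n)))
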